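{- For each integer $k\ge 2$ we have $n_2(k,2^{k-2},2)=2^{k-1}+1$.
   Context: An $[n,k,d]_q$-code is a $k$-dimensional subspace of $\mathbb{F}_q^n$ with minimum Hamming distance at least $d$. A linear code $C\subseteq\mathbb{F}_q^n$ has locality $r$ if for every coordinate $i$ there is a set $S_i\subseteq\{1,\dots,n\}\setminus\{i\}$ with $|S_i|\le r$ such that any two codewords agreeing on all coordinates in $S_i$ also agree in coordinate $i$. $n_q(k,d,r)$ denotes the minimum length $n$ of an $[n,k,d]_q$-code with locality $r$. -}

module Defs where

open import Data.Nat using (ℕ; zero; suc; _+_; _≤_; _<_)
open import Data.Bool using (Bool; true; false; _∧_; _xor_; if_then_else_)
open import Data.Fin using (Fin; zero; suc)
open import Data.Fin.Subset using (Subset; _∈_; _∉_; ∣_∣)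
open import Data.Product using (Σ; _×_)
open import Relation.Binary.PropositionalEquality using (_≡_)
open import Relation.Nullary using (¬_)
open import Function using (_∘_)

-- Words of length n over F_2 (F_2 = Bool, addition = xor, multiplication = ∧).
Word : ℕ → Set
Word n = Fin n → Bool

GenMatrix : ℕ → ℕ → Set
GenMatrix k n = Fin k → Word n

lincomb : ∀ {k n} → GenMatrix k n → (Fin k → Bool) → Word n
lincomb {zero}  G c i = false
lincomb {suc k} G c i = (c zero ∧ G zero i) xor lincomb (G ∘ suc) (c ∘ suc) i

weight : ∀ {n} → Word n → ℕ
weight {zero}  w = 0
weight {suc n} w = (if w zero then 1 else 0) + weight (w ∘ suc)

IsZeroWord : ∀ {n} → Word n → Set
IsZeroWord {n} w = ∀ i → w i ≡ false

-- Rows are linearly independent over F_2, so the code (row span) has dimension exactly k.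
LinIndep : ∀ {k n} → GenMatrix k n → Set
LinIndep G = ∀ c → IsZeroWord (lincomb G c) → ∀ j → c j ≡ false

-- Minimum Hamming distance at least d (for a linear code: every nonzero codeword has weight ≥ d).
MinDistAtLeast : ∀ {k n} → GenMatrix k n → ℕ → Set
MinDistAtLeast G d = ∀ c → ¬ IsZeroWord (lincomb G c) → d ≤ weight (lincomb G c)

HasLocality : ∀ {k n} → GenMatrix k n → ℕ → Set
HasLocality {k} {n} G r =
  ∀ (i : Fin n) → Σ (Subset n) λ S →
    i ∉ S × ∣ S ∣ ≤ r ×
    (∀ (c c' : Fin k → Bool) →
       (∀ j → j ∈ S → lincomb G c j ≡ lincomb G c' j) →
       lincomb G c i ≡ lincomb G c' i)

ExistsCode : ℕ → ℕ → ℕ → ℕ → Set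
ExistsCode n k d r =
  Σ (GenMatrix k n) λ G → LinIndep G × MinDistAtLeast G d × HasLocality G r

MinLengthIs : ℕ → ℕ → ℕ → ℕ → Set
MinLengthIs k d r N = ExistsCode N k d r × (∀ n → n < N → ¬ ExistsCode n k d r)

{-# OPTIONS --safe #-}
-- The code attaining the bound is the first-order Reed–Muller code RM(1, k − 1), of length
-- 2^(k−1) and distance 2^(k−2), with the message bit c₁ appended as an extra coordinate: every
-- codeword f satisfies f(y) + f(y + e₀) = c₁, a parity check of weight 3 through each coordinate,
-- so the locality is 2.
--
-- Conversely, let n ≤ 2^(k−1) and let S, with s = ∣ S ∣ ≤ 2, recover a coordinate i. The
-- messages whose codewords vanish on S form a subspace of size h ≥ 2^(k−s), and by locality
-- these codewords vanish at i too. Averaging the weight over this subcode (Plotkin), each of the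
-- other n − s − 1 coordinates is nonzero on at most h/2 codewords, while the h − 1 nonzero ones
-- have weight ≥ d = 2^(k−2). Hence 2d(h − 1) + (s + 1)h ≤ nh ≤ 2dh, so (s + 1)h ≤ 2d and
-- therefore 2(s + 1) ≤ 2^s, which fails for s ≤ 2.

module Submission where

open import Defs
open import Data.Nat using (ℕ; zero; suc; _+_; _*_; _∸_; _^_; _≤_; _<_; z≤n; s≤s; >-nonZero)
open import Data.Nat.Properties
open import Data.Nat.Tactic.RingSolver using (solve-∀)
open import Data.Bool.Base using (Bool; true; false; not; _∧_; _xor_; if_then_else_)
open import Data.Bool.Properties
  using (xor-∧-commutativeRing; xor-assoc; xor-comm; xor-same; xor-identityʳ; true-xor;
         ∧-assoc; ∧-identityʳ; ∧-zeroʳ; ∧-distribˡ-xor; ∧-distribʳ-xor; ¬-not)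
  renaming (_≟_ to _≟ᵇ_)
open import Data.Fin.Base using (Fin; zero; suc; splitAt; _↑ˡ_; _↑ʳ_; combine; remQuot)
open import Data.Fin.Properties
  using (splitAt-↑ˡ; splitAt-↑ʳ; splitAt⁻¹-↑ˡ; splitAt⁻¹-↑ʳ; ↑ˡ-injective; remQuot-combine; any?)
open import Data.Fin.Subset using (Subset; _∈_; _∉_; ∣_∣; ⁅_⁆; _∪_)
open import Data.Fin.Subset.Properties using (x∈⁅x⁆; x∈⁅y⁆⇒x≡y; ∣⁅x⁆∣≡1; x∈p∪q⁻; p⊆p∪q; q⊆p∪q)
open import Data.Vec.Base using (Vec; []; _∷_; here; there; lookup; zipWith; replicate; tabulate)
open import Data.Vec.Properties using (∷-injectiveʳ; tabulate∘lookup)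
open import Data.Product.Base using (Σ; ∃; ∃₂; _×_; _,_; proj₁; proj₂; uncurry)
open import Data.Sum.Base using (_⊎_; inj₁; inj₂)
open import Data.Empty using (⊥; ⊥-elim)
open import Function.Base using (_∘_)
open import Relation.Binary.PropositionalEquality
  using (_≡_; _≢_; refl; sym; trans; cong; cong₂; subst; module ≡-Reasoning)
open import Relation.Nullary using (¬_; yes; no; contradiction)
open import Relation.Nullary.Decidable using (from-no)
open import Algebra.Bundles using (CommutativeRing)
import Algebra.Properties.CommutativeSemigroup as CommSemigroupProps

open CommSemigroupProps (CommutativeRing.+-commutativeSemigroup xor-∧-commutativeRing)
  using () renaming (interchange to xor-interchange)
open CommSemigroupProps +-commutativeSemigroup
  using () renaming (interchange to +-interchange)

xor-cancelˡ : ∀ a b → a xor (a xor b) ≡ b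
xor-cancelˡ a b = trans (sym (xor-assoc a a b)) (cong (_xor b) (xor-same a))

xor-cancel-common : ∀ a b c → (a xor b) xor (a xor c) ≡ b xor c
xor-cancel-common a b c = trans (xor-interchange a b a c) (cong (_xor (b xor c)) (xor-same a))

xor-solve : ∀ {a b c} → a xor b ≡ c → b xor c ≡ a
xor-solve {a} {b} refl = trans (cong (b xor_) (xor-comm a b)) (xor-cancelˡ b a)

∧≡true⇒ : ∀ {a b} → a ∧ b ≡ true → a ≡ true × b ≡ true
∧≡true⇒ {true} {true} _ = refl , refl

not≡true⇒ : ∀ {a} → not a ≡ true → a ≡ false
not≡true⇒ {false} _ = refl

-- Linear algebra and counting over F₂

[_] : Bool → ℕ
[ b ] = if b then 1 else 0

_⊕_ : ∀ {k} → Vec Bool k → Vec Bool k → Vec Bool k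
_⊕_ = zipWith _xor_

⊕-cancelʳ : ∀ {k} (u v : Vec Bool k) → (u ⊕ v) ⊕ v ≡ u
⊕-cancelʳ [] [] = refl
⊕-cancelʳ (a ∷ u) (b ∷ v) =
  cong₂ _∷_ (trans (xor-assoc a b b) (trans (cong (a xor_) (xor-same b)) (xor-identityʳ a))) (⊕-cancelʳ u v)

unit : ∀ {k} → Fin k → Vec Bool k
unit zero = true ∷ replicate _ false
unit (suc r) = false ∷ unit r

⊕-unit-≢ : ∀ {k} (v : Vec Bool k) r → v ⊕ unit r ≢ v
⊕-unit-≢ (true ∷ v) zero ()
⊕-unit-≢ (false ∷ v) zero ()
⊕-unit-≢ (b ∷ v) (suc r) eq = ⊕-unit-≢ v r (∷-injectiveʳ eq)

IsLinear : ∀ {k} → (Vec Bool k → Bool) → Set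
IsLinear x = ∀ u v → x (u ⊕ v) ≡ x u xor x v

-- A nonempty ⊕-closed set is a subspace of F₂ᵏ, since u ⊕ u = 0.
⊕-Closed : ∀ {k} → (Vec Bool k → Bool) → Set
⊕-Closed Q = ∀ u v → Q u ≡ true → Q v ≡ true → Q (u ⊕ v) ≡ true

∧-⊕-closed : ∀ {k} {P Q : Vec Bool k → Bool} → ⊕-Closed P → ⊕-Closed Q → ⊕-Closed (λ c → P c ∧ Q c)
∧-⊕-closed closedP closedQ u v pqu pqv with ∧≡true⇒ pqu | ∧≡true⇒ pqv
... | pu , qu | pv , qv = cong₂ _∧_ (closedP u v pu pv) (closedQ u v qu qv)

not-linear-⊕-closed : ∀ {k} {x : Vec Bool k → Bool} → IsLinear x → ⊕-Closed (λ c → not (x c))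
not-linear-⊕-closed {x = x} linear u v xu xv
  rewrite linear u v | not≡true⇒ {x u} xu | not≡true⇒ {x v} xv = refl

⊕-closed-translate : ∀ {k} {Q : Vec Bool k → Bool} {v} → ⊕-Closed Q → Q v ≡ true → ∀ c → Q (c ⊕ v) ≡ Q c
⊕-closed-translate {Q = Q} {v} closed qv c with Q c in qc | Q (c ⊕ v) in qcv
... | true  | _     = trans (sym qcv) (closed c v qc qv)
... | false | false = refl
... | false | true  = trans (sym (subst (λ u → Q u ≡ true) (⊕-cancelʳ c v) (closed _ _ qcv qv))) qc

∑ : ∀ {k} → (Vec Bool k → ℕ) → ℕ
∑ {zero} f = f []
∑ {suc k} f = ∑ (f ∘ (false ∷_)) + ∑ (f ∘ (true ∷_))

count : ∀ {k} → (Vec Bool k → Bool) → ℕ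
count P = ∑ (λ c → [ P c ])

∑-cong : ∀ {k} {f g : Vec Bool k → ℕ} → (∀ c → f c ≡ g c) → ∑ f ≡ ∑ g
∑-cong {zero} f≡g = f≡g []
∑-cong {suc k} f≡g = cong₂ _+_ (∑-cong (f≡g ∘ (false ∷_))) (∑-cong (f≡g ∘ (true ∷_)))

∑-mono-≤ : ∀ {k} {f g : Vec Bool k → ℕ} → (∀ c → f c ≤ g c) → ∑ f ≤ ∑ g
∑-mono-≤ {zero} f≤g = f≤g []
∑-mono-≤ {suc k} f≤g = +-mono-≤ (∑-mono-≤ (f≤g ∘ (false ∷_))) (∑-mono-≤ (f≤g ∘ (true ∷_)))

∑-distrib-+ : ∀ {k} (f g : Vec Bool k → ℕ) → ∑ (λ c → f c + g c) ≡ ∑ f + ∑ g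
∑-distrib-+ {zero} f g = refl
∑-distrib-+ {suc k} f g = begin
  ∑ (λ c → f (false ∷ c) + g (false ∷ c)) + ∑ (λ c → f (true ∷ c) + g (true ∷ c))
    ≡⟨ cong₂ _+_ (∑-distrib-+ (f ∘ (false ∷_)) (g ∘ (false ∷_))) (∑-distrib-+ (f ∘ (true ∷_)) (g ∘ (true ∷_))) ⟩
  (∑ (f ∘ (false ∷_)) + ∑ (g ∘ (false ∷_))) + (∑ (f ∘ (true ∷_)) + ∑ (g ∘ (true ∷_)))
    ≡⟨ +-interchange (∑ (f ∘ (false ∷_))) (∑ (g ∘ (false ∷_))) (∑ (f ∘ (true ∷_))) (∑ (g ∘ (true ∷_))) ⟩
  ∑ f + ∑ g ∎
  where open ≡-Reasoning

∑-distribʳ-* : ∀ {k} (f : Vec Bool k → ℕ) m → ∑ (λ c → f c * m) ≡ ∑ f * m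
∑-distribʳ-* {zero} f m = refl
∑-distribʳ-* {suc k} f m =
  trans (cong₂ _+_ (∑-distribʳ-* (f ∘ (false ∷_)) m) (∑-distribʳ-* (f ∘ (true ∷_)) m))
        (sym (*-distribʳ-+ m (∑ (f ∘ (false ∷_))) _))

∑-const : ∀ {k} m → ∑ {k} (λ _ → m) ≡ 2 ^ k * m
∑-const {zero} m = sym (+-identityʳ m)
∑-const {suc k} m = trans (cong₂ _+_ (∑-const {k} m) (∑-const {k} m)) (double (2 ^ k) m)
  where
  double : ∀ a m → a * m + a * m ≡ 2 * a * m
  double = solve-∀

∑-zero : ∀ {k} {f : Vec Bool k → ℕ} → (∀ c → f c ≡ 0) → ∑ f ≡ 0
∑-zero {k} f≡0 = trans (∑-cong f≡0) (trans (∑-const {k} 0) (*-zeroʳ (2 ^ k)))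

-- Translation by v permutes F₂ᵏ: on the first coordinate it is the identity or the swap.
∑-translate : ∀ {k} (f : Vec Bool k → ℕ) v → ∑ (λ c → f (c ⊕ v)) ≡ ∑ f
∑-translate {zero} f [] = refl
∑-translate {suc k} f (false ∷ v) = cong₂ _+_ (∑-translate (f ∘ (false ∷_)) v) (∑-translate (f ∘ (true ∷_)) v)
∑-translate {suc k} f (true ∷ v) =
  trans (cong₂ _+_ (∑-translate (f ∘ (true ∷_)) v) (∑-translate (f ∘ (false ∷_)) v))
        (+-comm (∑ (f ∘ (true ∷_))) _)

count-witness : ∀ {k} (P : Vec Bool k → Bool) → 0 < count P → ∃ λ c → P c ≡ true
count-witness {zero} P positive with P [] in eq
count-witness {zero} P positive | true = [] , eq
count-witness {zero} P ()       | false
count-witness {suc k} P positive with count (P ∘ (false ∷_)) in eq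
... | suc _ = let c , pc = count-witness (P ∘ (false ∷_)) (subst (0 <_) (sym eq) (s≤s z≤n)) in false ∷ c , pc
... | zero  = let c , pc = count-witness (P ∘ (true ∷_)) positive in true ∷ c , pc

count-split : ∀ {k} (P x : Vec Bool k → Bool) →
  count (λ c → P c ∧ x c) + count (λ c → P c ∧ not (x c)) ≡ count P
count-split P x = trans (sym (∑-distrib-+ (λ c → [ P c ∧ x c ]) (λ c → [ P c ∧ not (x c) ]))) (∑-cong pointwise)
  where
  pointwise : ∀ c → [ P c ∧ x c ] + [ P c ∧ not (x c) ] ≡ [ P c ]
  pointwise c with P c | x c
  ... | false | _     = refl
  ... | true  | false = refl
  ... | true  | true  = refl

-- Translating by a vector v ∈ Q with x v = 1 swaps the two halves of Q cut out by x.
count-∧-linear≡ : ∀ {k} {Q x : Vec Bool k → Bool} {v} → ⊕-Closed Q → IsLinear x → Q v ≡ true → x v ≡ true →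
  count (λ c → Q c ∧ x c) ≡ count (λ c → Q c ∧ not (x c))
count-∧-linear≡ {Q = Q} {x} {v} closed linear qv xv =
  trans (sym (∑-translate (λ c → [ Q c ∧ x c ]) v)) (∑-cong pointwise)
  where
  pointwise : ∀ c → [ Q (c ⊕ v) ∧ x (c ⊕ v) ] ≡ [ Q c ∧ not (x c) ]
  pointwise c = cong₂ (λ a b → [ a ∧ b ])
    (⊕-closed-translate closed qv c)
    (trans (linear c v) (trans (cong (x c xor_) xv) (trans (xor-comm (x c) true) (true-xor (x c)))))

count-∧-linear≤ : ∀ {k} {Q x : Vec Bool k → Bool} → ⊕-Closed Q → IsLinear x →
  count (λ c → Q c ∧ x c) ≤ count (λ c → Q c ∧ not (x c))
count-∧-linear≤ {Q = Q} {x} closed linear with count (λ c → Q c ∧ x c) in eq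
... | zero  = z≤n
... | suc _ with count-witness (λ c → Q c ∧ x c) (subst (0 <_) (sym eq) (s≤s z≤n))
...   | v , qxv = let qv , xv = ∧≡true⇒ qxv in
                  ≤-reflexive (trans (sym eq) (count-∧-linear≡ closed linear qv xv))

2*count-∧-linear≤count : ∀ {k} {Q x : Vec Bool k → Bool} → ⊕-Closed Q → IsLinear x →
  2 * count (λ c → Q c ∧ x c) ≤ count Q
2*count-∧-linear≤count {Q = Q} {x} closed linear = begin
  count (λ c → Q c ∧ x c) + (count (λ c → Q c ∧ x c) + 0)
    ≡⟨ cong (count (λ c → Q c ∧ x c) +_) (+-identityʳ _) ⟩
  count (λ c → Q c ∧ x c) + count (λ c → Q c ∧ x c)
    ≤⟨ +-monoʳ-≤ (count (λ c → Q c ∧ x c)) (count-∧-linear≤ closed linear) ⟩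
  count (λ c → Q c ∧ x c) + count (λ c → Q c ∧ not (x c))
    ≡⟨ count-split Q x ⟩
  count Q ∎
  where open ≤-Reasoning

count≤2*count-∧-not : ∀ {k} {Q x : Vec Bool k → Bool} → ⊕-Closed Q → IsLinear x →
  count Q ≤ 2 * count (λ c → Q c ∧ not (x c))
count≤2*count-∧-not {Q = Q} {x} closed linear = begin
  count Q
    ≡⟨ count-split Q x ⟨
  count (λ c → Q c ∧ x c) + count (λ c → Q c ∧ not (x c))
    ≤⟨ +-monoˡ-≤ (count (λ c → Q c ∧ not (x c))) (count-∧-linear≤ closed linear) ⟩
  count (λ c → Q c ∧ not (x c)) + count (λ c → Q c ∧ not (x c))
    ≡⟨ cong (count (λ c → Q c ∧ not (x c)) +_) (+-identityʳ _) ⟨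
  2 * count (λ c → Q c ∧ not (x c)) ∎
  where open ≤-Reasoning

2*count-linear≡ : ∀ {k} {x : Vec Bool k → Bool} {v} → IsLinear x → x v ≡ true → 2 * count x ≡ 2 ^ k
2*count-linear≡ {k} {x} linear xv = begin
  count x + (count x + 0)
    ≡⟨ cong (count x +_) (trans (+-identityʳ _)
         (count-∧-linear≡ {Q = λ _ → true} (λ _ _ _ _ → refl) linear refl xv)) ⟩
  count x + count (λ c → not (x c))
    ≡⟨ count-split (λ _ → true) x ⟩
  ∑ {k} (λ _ → 1)
    ≡⟨ trans (∑-const {k} 1) (*-identityʳ (2 ^ k)) ⟩
  2 ^ k ∎
  where open ≡-Reasoning

2*count-affine≡ : ∀ {k} {x : Vec Bool k → Bool} {v} → IsLinear x → x v ≡ true →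
  ∀ b → 2 * count (λ y → b xor x y) ≡ 2 ^ k
2*count-affine≡ linear xv false = 2*count-linear≡ linear xv
2*count-affine≡ linear xv true =
  trans (cong (2 *_) (sym (count-∧-linear≡ {Q = λ _ → true} (λ _ _ _ _ → refl) linear refl xv)))
        (2*count-linear≡ linear xv)

kernel : ∀ {n k} → Subset n → (Fin n → Vec Bool k → Bool) → Vec Bool k → Bool
kernel [] X c = true
kernel (true ∷ S) X c = not (X zero c) ∧ kernel S (X ∘ suc) c
kernel (false ∷ S) X c = kernel S (X ∘ suc) c

kernel-vanishes : ∀ {n k} (S : Subset n) (X : Fin n → Vec Bool k → Bool) {j c} →
  j ∈ S → kernel S X c ≡ true → X j c ≡ false
kernel-vanishes (true ∷ S) X here inS = not≡true⇒ (proj₁ (∧≡true⇒ inS))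
kernel-vanishes (true ∷ S) X (there j∈S) inS = kernel-vanishes S (X ∘ suc) j∈S (proj₂ (∧≡true⇒ inS))
kernel-vanishes (false ∷ S) X (there j∈S) inS = kernel-vanishes S (X ∘ suc) j∈S inS

kernel-⊕-closed : ∀ {n k} (S : Subset n) {X : Fin n → Vec Bool k → Bool} → (∀ j → IsLinear (X j)) →
  ⊕-Closed (kernel S X)
kernel-⊕-closed [] _ _ _ _ _ = refl
kernel-⊕-closed (true ∷ S) linear =
  ∧-⊕-closed (not-linear-⊕-closed (linear zero)) (kernel-⊕-closed S (linear ∘ suc))
kernel-⊕-closed (false ∷ S) linear = kernel-⊕-closed S (linear ∘ suc)

-- Each of the ∣ S ∣ linear conditions at most halves the ⊕-closed set Q.
count≤2^∣S∣*count-kernel : ∀ {n k} (S : Subset n) {Q : Vec Bool k → Bool} {X} →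
  ⊕-Closed Q → (∀ j → IsLinear (X j)) →
  count Q ≤ 2 ^ ∣ S ∣ * count (λ c → Q c ∧ kernel S X c)
count≤2^∣S∣*count-kernel [] {Q} _ _ =
  ≤-reflexive (trans (∑-cong λ c → cong [_] (sym (∧-identityʳ (Q c)))) (sym (+-identityʳ _)))
count≤2^∣S∣*count-kernel (false ∷ S) closed linear = count≤2^∣S∣*count-kernel S closed (linear ∘ suc)
count≤2^∣S∣*count-kernel (true ∷ S) {Q} {X} closed linear = begin
  count Q
    ≤⟨ count≤2*count-∧-not closed (linear zero) ⟩
  2 * count Q′
    ≤⟨ *-monoʳ-≤ 2 (count≤2^∣S∣*count-kernel S
         (∧-⊕-closed closed (not-linear-⊕-closed (linear zero))) (linear ∘ suc)) ⟩
  2 * (2 ^ ∣ S ∣ * count (λ c → Q′ c ∧ kernel S (X ∘ suc) c))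
    ≡⟨ sym (*-assoc 2 (2 ^ ∣ S ∣) _) ⟩
  2 ^ suc ∣ S ∣ * count (λ c → Q′ c ∧ kernel S (X ∘ suc) c)
    ≡⟨ cong (2 ^ suc ∣ S ∣ *_) (∑-cong λ c → cong [_] (∧-assoc (Q c) _ _)) ⟩
  2 ^ suc ∣ S ∣ * count (λ c → Q c ∧ kernel (true ∷ S) X c) ∎
  where
  open ≤-Reasoning
  Q′ : Vec Bool _ → Bool
  Q′ c = Q c ∧ not (X zero c)

weightSum : ∀ {k n} → (Vec Bool k → Bool) → (Vec Bool k → Word n) → ℕ
weightSum Q w = ∑ (λ c → [ Q c ] * weight (w c))

weightSum-suc : ∀ {k n} (Q : Vec Bool k → Bool) (w : Vec Bool k → Word (suc n)) →
  weightSum Q w ≡ count (λ c → Q c ∧ w c zero) + weightSum Q (λ c → w c ∘ suc)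
weightSum-suc Q w =
  trans (∑-cong pointwise) (∑-distrib-+ (λ c → [ Q c ∧ w c zero ]) (λ c → [ Q c ] * weight (w c ∘ suc)))
  where
  pointwise : ∀ c → [ Q c ] * weight (w c) ≡ [ Q c ∧ w c zero ] + [ Q c ] * weight (w c ∘ suc)
  pointwise c with Q c
  ... | false = refl
  ... | true  = trans (*-identityˡ _) (cong ([ w c zero ] +_) (sym (*-identityˡ _)))

-- Plotkin's averaging argument, summing the weights column by column.
plotkin-bound : ∀ {k} n (w : Vec Bool k → Word n) (Q : Vec Bool k → Bool) (T : Subset n) →
  (∀ j → j ∈ T → ∀ c → Q c ≡ true → w c j ≡ false) →
  (∀ j → 2 * count (λ c → Q c ∧ w c j) ≤ count Q) →
  2 * weightSum Q w + ∣ T ∣ * count Q ≤ n * count Q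
plotkin-bound zero w Q [] _ _ =
  ≤-reflexive (cong (λ W → 2 * W + 0) (∑-zero λ c → *-zeroʳ [ Q c ]))
plotkin-bound (suc n) w Q (false ∷ T) vanish half = begin
  2 * weightSum Q w + ∣ T ∣ * h
    ≡⟨ cong (λ W → 2 * W + ∣ T ∣ * h) (weightSum-suc Q w) ⟩
  2 * (a + W′) + ∣ T ∣ * h
    ≡⟨ shuffle a W′ (∣ T ∣ * h) ⟩
  2 * a + (2 * W′ + ∣ T ∣ * h)
    ≤⟨ +-mono-≤ (half zero)
         (plotkin-bound n (λ c → w c ∘ suc) Q T (λ j j∈T → vanish (suc j) (there j∈T)) (half ∘ suc)) ⟩
  h + n * h ∎
  where
  open ≤-Reasoning
  h = count Q
  a = count (λ c → Q c ∧ w c zero)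
  W′ = weightSum Q (λ c → w c ∘ suc)
  shuffle : ∀ a W t → 2 * (a + W) + t ≡ 2 * a + (2 * W + t)
  shuffle = solve-∀
plotkin-bound (suc n) w Q (true ∷ T) vanish half = begin
  2 * weightSum Q w + (h + ∣ T ∣ * h)
    ≡⟨ cong (λ W → 2 * W + (h + ∣ T ∣ * h)) (trans (weightSum-suc Q w) (cong (_+ W′) column-zero)) ⟩
  2 * (0 + W′) + (h + ∣ T ∣ * h)
    ≡⟨ shuffle W′ h (∣ T ∣ * h) ⟩
  h + (2 * W′ + ∣ T ∣ * h)
    ≤⟨ +-monoʳ-≤ h (plotkin-bound n (λ c → w c ∘ suc) Q T (λ j j∈T → vanish (suc j) (there j∈T)) (half ∘ suc)) ⟩
  h + n * h ∎
  where
  open ≤-Reasoning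
  h = count Q
  W′ = weightSum Q (λ c → w c ∘ suc)
  column-zero : count (λ c → Q c ∧ w c zero) ≡ 0
  column-zero = ∑-zero pointwise
    where
    pointwise : ∀ c → [ Q c ∧ w c zero ] ≡ 0
    pointwise c with Q c in qc
    ... | false = refl
    ... | true  = cong [_] (vanish zero here c qc)
  shuffle : ∀ W h t → 2 * (0 + W) + (h + t) ≡ h + (2 * W + t)
  shuffle = solve-∀

isZero : ∀ {k} → Vec Bool k → Bool
isZero [] = true
isZero (b ∷ c) = not b ∧ isZero c

count-isZero : ∀ {k} → count (isZero {k}) ≡ 1
count-isZero {zero} = refl
count-isZero {suc k} = cong₂ _+_ (count-isZero {k}) (∑-zero {k} λ _ → refl)

isZero≡false⇒ : ∀ {k} (c : Vec Bool k) → isZero c ≡ false → ∃ λ j → lookup c j ≡ true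
isZero≡false⇒ (true ∷ c) _ = zero , refl
isZero≡false⇒ (false ∷ c) nonzero = let j , cj = isZero≡false⇒ c nonzero in suc j , cj

-- Only the zero vector may fall short of weight d.
weightSum-lower : ∀ {k n} (Q : Vec Bool k → Bool) (w : Vec Bool k → Word n) d →
  (∀ c j → lookup c j ≡ true → d ≤ weight (w c)) →
  count Q * d ≤ weightSum Q w + d
weightSum-lower {k} Q w d heavy = begin
  count Q * d
    ≡⟨ ∑-distribʳ-* (λ c → [ Q c ]) d ⟨
  ∑ (λ c → [ Q c ] * d)
    ≤⟨ ∑-mono-≤ pointwise ⟩
  ∑ (λ c → [ Q c ] * weight (w c) + [ isZero c ] * d)
    ≡⟨ ∑-distrib-+ (λ c → [ Q c ] * weight (w c)) (λ c → [ isZero {k} c ] * d) ⟩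
  weightSum Q w + ∑ (λ c → [ isZero {k} c ] * d)
    ≡⟨ cong (weightSum Q w +_)
         (trans (∑-distribʳ-* (λ c → [ isZero {k} c ]) d) (cong (_* d) (count-isZero {k}))) ⟩
  weightSum Q w + 1 * d
    ≡⟨ cong (weightSum Q w +_) (*-identityˡ d) ⟩
  weightSum Q w + d ∎
  where
  open ≤-Reasoning
  pointwise : ∀ c → [ Q c ] * d ≤ [ Q c ] * weight (w c) + [ isZero c ] * d
  pointwise c with Q c | isZero c in zc
  ... | false | _     = z≤n
  ... | true  | true  = m≤n+m (1 * d) (1 * weight (w c))
  ... | true  | false = let j , cj = isZero≡false⇒ c zc in
                        ≤-trans (*-monoʳ-≤ 1 (heavy c j cj)) (m≤m+n (1 * weight (w c)) 0)

-- Codes and the lower bound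

dot : ∀ {k} → (Fin k → Bool) → Vec Bool k → Bool
dot c [] = false
dot c (b ∷ v) = (c zero ∧ b) xor dot (c ∘ suc) v

lincomb≡dot : ∀ {k n} (G : GenMatrix k n) c p → lincomb G c p ≡ dot c (tabulate (λ r → G r p))
lincomb≡dot {zero} G c p = refl
lincomb≡dot {suc k} G c p = cong ((c zero ∧ G zero p) xor_) (lincomb≡dot (G ∘ suc) (c ∘ suc) p)

dot-linear : ∀ {k} (c : Fin k → Bool) → IsLinear (dot c)
dot-linear c [] [] = refl
dot-linear c (a ∷ u) (b ∷ v) = begin
  (c zero ∧ (a xor b)) xor dot (c ∘ suc) (u ⊕ v)
    ≡⟨ cong₂ _xor_ (∧-distribˡ-xor (c zero) a b) (dot-linear (c ∘ suc) u v) ⟩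
  ((c zero ∧ a) xor (c zero ∧ b)) xor (dot (c ∘ suc) u xor dot (c ∘ suc) v)
    ≡⟨ xor-interchange (c zero ∧ a) _ _ _ ⟩
  ((c zero ∧ a) xor dot (c ∘ suc) u) xor ((c zero ∧ b) xor dot (c ∘ suc) v) ∎
  where open ≡-Reasoning

dot-zeroˡ : ∀ {k} {c : Fin k → Bool} → (∀ r → c r ≡ false) → ∀ v → dot c v ≡ false
dot-zeroˡ c≡0 [] = refl
dot-zeroˡ c≡0 (b ∷ v) rewrite c≡0 zero = dot-zeroˡ (c≡0 ∘ suc) v

dot-zeroʳ : ∀ {k} (c : Fin k → Bool) → dot c (replicate k false) ≡ false
dot-zeroʳ {zero} c = refl
dot-zeroʳ {suc k} c rewrite ∧-zeroʳ (c zero) = dot-zeroʳ (c ∘ suc)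

dot-unit : ∀ {k} (c : Fin k → Bool) r → dot c (unit r) ≡ c r
dot-unit c zero rewrite ∧-identityʳ (c zero) | dot-zeroʳ (c ∘ suc) = xor-identityʳ (c zero)
dot-unit c (suc r) rewrite ∧-zeroʳ (c zero) = dot-unit (c ∘ suc) r

lincomb-zero : ∀ {k n} (G : GenMatrix k n) {c} → (∀ r → c r ≡ false) → IsZeroWord (lincomb G c)
lincomb-zero G c≡0 p = trans (lincomb≡dot G _ p) (dot-zeroˡ c≡0 (tabulate (λ r → G r p)))

lincomb-linear : ∀ {k n} (G : GenMatrix k n) j → IsLinear (λ c → lincomb G (lookup c) j)
lincomb-linear G j [] [] = refl
lincomb-linear G j (a ∷ u) (b ∷ v) = begin
  ((a xor b) ∧ G zero j) xor lincomb (G ∘ suc) (lookup (u ⊕ v)) j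
    ≡⟨ cong₂ _xor_ (∧-distribʳ-xor (G zero j) a b) (lincomb-linear (G ∘ suc) j u v) ⟩
  ((a ∧ G zero j) xor (b ∧ G zero j)) xor (lincomb (G ∘ suc) (lookup u) j xor lincomb (G ∘ suc) (lookup v) j)
    ≡⟨ xor-interchange (a ∧ G zero j) _ _ _ ⟩
  ((a ∧ G zero j) xor lincomb (G ∘ suc) (lookup u) j) xor ((b ∧ G zero j) xor lincomb (G ∘ suc) (lookup v) j) ∎
  where open ≡-Reasoning

weight-cong : ∀ {n} {w w′ : Word n} → (∀ i → w i ≡ w′ i) → weight w ≡ weight w′
weight-cong {zero} _ = refl
weight-cong {suc n} w≡w′ = cong₂ _+_ (cong [_] (w≡w′ zero)) (weight-cong (w≡w′ ∘ suc))

weight-++ : ∀ m {n} (w : Word (m + n)) → weight w ≡ weight (λ i → w (i ↑ˡ n)) + weight (λ i → w (m ↑ʳ i))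
weight-++ zero w = refl
weight-++ (suc m) w = trans (cong ([ w zero ] +_) (weight-++ m (w ∘ suc))) (sym (+-assoc [ w zero ] _ _))

weight-halves : ∀ n (w : Word (2 * n)) →
  weight w ≡ weight (w ∘ combine {2} {n} zero) + weight (w ∘ combine {2} {n} (suc zero))
weight-halves n w =
  trans (weight-++ n w)
        (cong (weight (w ∘ combine {2} {n} zero) +_) (trans (weight-++ n (λ i → w (n ↑ʳ i))) (+-identityʳ _)))

weight-zero : ∀ {n} {w : Word n} → IsZeroWord w → weight w ≡ 0
weight-zero {zero} _ = refl
weight-zero {suc n} w≡0 rewrite w≡0 zero = weight-zero (w≡0 ∘ suc)

WeightsAtLeast : ∀ {k n} → GenMatrix k n → ℕ → Set
WeightsAtLeast G d = ∀ c j → c j ≡ true → d ≤ weight (lincomb G c)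

linIndep×minDist⇒weightsAtLeast : ∀ {k n} {G : GenMatrix k n} {d} →
  LinIndep G → MinDistAtLeast G d → WeightsAtLeast G d
linIndep×minDist⇒weightsAtLeast independent distance c j cj =
  distance c λ zero-word → contradiction (trans (sym cj) (independent c zero-word j)) λ ()

weightsAtLeast⇒linIndep : ∀ {k n} {G : GenMatrix k n} {d} → 0 < d → WeightsAtLeast G d → LinIndep G
weightsAtLeast⇒linIndep positive heavy c zero-word j =
  ¬-not λ cj → <⇒≱ positive (≤-trans (heavy c j cj) (≤-reflexive (weight-zero zero-word)))

weightsAtLeast⇒minDist : ∀ {k n} {G : GenMatrix k n} {d} → WeightsAtLeast G d → MinDistAtLeast G d
weightsAtLeast⇒minDist {G = G} heavy c nonzero-word with any? (λ j → c j ≟ᵇ true)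
... | yes (j , cj) = heavy c j cj
... | no  c≡0      = contradiction (lincomb-zero G λ r → ¬-not λ cr → c≡0 (r , cr)) nonzero-word

-- The messages whose codewords vanish on a recovery set S of coordinate 0 form a subcode of
-- dimension ≥ k − ∣ S ∣ vanishing on S ∪ {0}; apply the Plotkin averaging to it.
shortened-plotkin : ∀ {k n d r} → ExistsCode (suc n) k d r →
  ∃₂ λ s h → s ≤ r × 2 ^ k ≤ 2 ^ s * h × 2 * (h * d) + suc s * h ≤ suc n * h + 2 * d
shortened-plotkin (G , independent , distance , locality) with locality zero
... | (true ∷ _) , zero∉S , _ , _ = ⊥-elim (zero∉S here)
shortened-plotkin {k} {n} {d} (G , independent , distance , locality)
  | S@(false ∷ S′) , _ , ∣S∣≤r , recover = ∣ S ∣ , h , ∣S∣≤r , dimension , bound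
  where
  X : Fin (suc n) → Vec Bool k → Bool
  X j c = lincomb G (lookup c) j
  Q = kernel S X
  h = count Q
  W = weightSum Q (lincomb G ∘ lookup)
  vanish : ∀ j → j ∈ true ∷ S′ → ∀ c → Q c ≡ true → X j c ≡ false
  vanish zero here c qc =
    trans (recover (lookup c) (λ _ → false) λ j j∈S →
             trans (kernel-vanishes S X j∈S qc) (sym (lincomb-zero G (λ _ → refl) j)))
          (lincomb-zero G (λ _ → refl) zero)
  vanish (suc j) (there j∈S′) c qc = kernel-vanishes S X (there j∈S′) qc
  dimension : 2 ^ k ≤ 2 ^ ∣ S ∣ * h
  dimension = ≤-trans (≤-reflexive (sym (trans (∑-const {k} 1) (*-identityʳ (2 ^ k)))))
                      (count≤2^∣S∣*count-kernel S {X = X} (λ _ _ _ _ → refl) (lincomb-linear G))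
  plotkin : 2 * W + suc ∣ S ∣ * h ≤ suc n * h
  plotkin = plotkin-bound (suc n) (lincomb G ∘ lookup) Q (true ∷ S′) vanish
    λ j → 2*count-∧-linear≤count (kernel-⊕-closed S {X} (lincomb-linear G)) (lincomb-linear G j)
  bound : 2 * (h * d) + suc ∣ S ∣ * h ≤ suc n * h + 2 * d
  bound = begin
    2 * (h * d) + suc ∣ S ∣ * h
      ≤⟨ +-monoˡ-≤ (suc ∣ S ∣ * h) (*-monoʳ-≤ 2
           (weightSum-lower Q (lincomb G ∘ lookup) d λ c →
              linIndep×minDist⇒weightsAtLeast independent distance (lookup c))) ⟩
    2 * (W + d) + suc ∣ S ∣ * h
      ≡⟨ shuffle W d (suc ∣ S ∣ * h) ⟩
    (2 * W + suc ∣ S ∣ * h) + 2 * d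
      ≤⟨ +-monoˡ-≤ (2 * d) plotkin ⟩
    suc n * h + 2 * d ∎
    where
    open ≤-Reasoning
    shuffle : ∀ W d t → 2 * (W + d) + t ≡ (2 * W + t) + 2 * d
    shuffle = solve-∀

shortened-plotkin-infeasible : ∀ d s h n → 0 < d → s ≤ 2 → n ≤ 2 * d → 2 * (2 * d) ≤ 2 ^ s * h →
  2 * (h * d) + suc s * h ≤ n * h + 2 * d → ⊥
shortened-plotkin-infeasible d s h n d>0 s≤2 n≤2d dimension bound =
  2^s<2[1+s] s s≤2 (*-cancelʳ-≤ (suc s * 2) (2 ^ s) (2 * d) {{>-nonZero (*-monoʳ-< 2 d>0)}} scaled)
  where
  open ≤-Reasoning
  subcode-size : suc s * h ≤ 2 * d
  subcode-size = +-cancelˡ-≤ (2 * (h * d)) _ _ (begin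
    2 * (h * d) + suc s * h ≤⟨ bound ⟩
    n * h + 2 * d           ≤⟨ +-monoˡ-≤ (2 * d) (*-monoˡ-≤ h n≤2d) ⟩
    2 * d * h + 2 * d       ≡⟨ cong (_+ 2 * d) (swap d h) ⟩
    2 * (h * d) + 2 * d     ∎)
    where
    swap : ∀ d h → 2 * d * h ≡ 2 * (h * d)
    swap = solve-∀
  scaled : suc s * 2 * (2 * d) ≤ 2 ^ s * (2 * d)
  scaled = begin
    suc s * 2 * (2 * d)   ≡⟨ *-assoc (suc s) 2 (2 * d) ⟩
    suc s * (2 * (2 * d)) ≤⟨ *-monoʳ-≤ (suc s) dimension ⟩
    suc s * (2 ^ s * h)   ≡⟨ swap (2 ^ s) s h ⟩
    2 ^ s * (suc s * h)   ≤⟨ *-monoʳ-≤ (2 ^ s) subcode-size ⟩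
    2 ^ s * (2 * d)       ∎
    where
    swap : ∀ a s h → suc s * (a * h) ≡ a * (suc s * h)
    swap = solve-∀
  2^s<2[1+s] : ∀ s → s ≤ 2 → ¬ (suc s * 2 ≤ 2 ^ s)
  2^s<2[1+s] 0 _ = from-no (2 ≤? 1)
  2^s<2[1+s] 1 _ = from-no (4 ≤? 2)
  2^s<2[1+s] 2 _ = from-no (6 ≤? 4)
  2^s<2[1+s] (suc (suc (suc _))) (s≤s (s≤s ()))

-- The construction

toBool : Fin 2 → Bool
toBool zero = false
toBool (suc zero) = true

fromBool : Bool → Fin 2
fromBool false = zero
fromBool true = suc zero

toBool-fromBool : ∀ b → toBool (fromBool b) ≡ b
toBool-fromBool false = refl
toBool-fromBool true = refl

-- The binary expansion of an index, most significant bit first.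
bits : ∀ {M} → Fin (2 ^ M) → Vec Bool M
bits {zero} _ = []
bits {suc M} i = uncurry (λ b j → toBool b ∷ bits j) (remQuot (2 ^ M) i)

index : ∀ {M} → Vec Bool M → Fin (2 ^ M)
index [] = zero
index (b ∷ v) = combine (fromBool b) (index v)

bits-combine : ∀ {M} b (j : Fin (2 ^ M)) → bits (combine b j) ≡ toBool b ∷ bits j
bits-combine {M} b j = cong (uncurry (λ b j → toBool b ∷ bits {M} j)) (remQuot-combine {2} {2 ^ M} b j)

bits-index : ∀ {M} (v : Vec Bool M) → bits (index v) ≡ v
bits-index [] = refl
bits-index (b ∷ v) = trans (bits-combine (fromBool b) (index v)) (cong₂ _∷_ (toBool-fromBool b) (bits-index v))

weight-bits : ∀ {M} (f : Vec Bool M → Bool) → weight (f ∘ bits) ≡ count f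
weight-bits {zero} f = +-identityʳ _
weight-bits {suc M} f = begin
  weight (f ∘ bits)
    ≡⟨ weight-halves (2 ^ M) (f ∘ bits) ⟩
  weight (f ∘ bits ∘ combine {2} {2 ^ M} zero) + weight (f ∘ bits ∘ combine {2} {2 ^ M} (suc zero))
    ≡⟨ cong₂ _+_ (weight-cong λ j → cong f (bits-combine {M} zero j))
                 (weight-cong λ j → cong f (bits-combine {M} (suc zero) j)) ⟩
  weight (f ∘ (false ∷_) ∘ bits) + weight (f ∘ (true ∷_) ∘ bits)
    ≡⟨ cong₂ _+_ (weight-bits (f ∘ (false ∷_))) (weight-bits (f ∘ (true ∷_))) ⟩
  count f ∎
  where open ≡-Reasoning

↑ˡ≢↑ʳ : ∀ {m n} (i : Fin m) (j : Fin n) → i ↑ˡ n ≢ m ↑ʳ j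
↑ˡ≢↑ʳ {m} {n} i j eq with trans (sym (splitAt-↑ˡ m i n)) (trans (cong (splitAt m) eq) (splitAt-↑ʳ m n j))
... | ()

∣p∪q∣≤∣p∣+∣q∣ : ∀ {n} (p q : Subset n) → ∣ p ∪ q ∣ ≤ ∣ p ∣ + ∣ q ∣
∣p∪q∣≤∣p∣+∣q∣ [] [] = z≤n
∣p∪q∣≤∣p∣+∣q∣ (true ∷ p) (true ∷ q) = s≤s (≤-trans (∣p∪q∣≤∣p∣+∣q∣ p q) (+-monoʳ-≤ ∣ p ∣ (n≤1+n _)))
∣p∪q∣≤∣p∣+∣q∣ (true ∷ p) (false ∷ q) = s≤s (∣p∪q∣≤∣p∣+∣q∣ p q)
∣p∪q∣≤∣p∣+∣q∣ (false ∷ p) (true ∷ q) = ≤-trans (s≤s (∣p∪q∣≤∣p∣+∣q∣ p q)) (≤-reflexive (sym (+-suc ∣ p ∣ ∣ q ∣)))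
∣p∪q∣≤∣p∣+∣q∣ (false ∷ p) (false ∷ q) = ∣p∪q∣≤∣p∣+∣q∣ p q

LocalAt : ∀ {k n} → GenMatrix k n → ℕ → Fin n → Set
LocalAt {k} {n} G r i = Σ (Subset n) λ S →
  i ∉ S × ∣ S ∣ ≤ r ×
  (∀ (c c′ : Fin k → Bool) → (∀ j → j ∈ S → lincomb G c j ≡ lincomb G c′ j) → lincomb G c i ≡ lincomb G c′ i)

parity⇒local : ∀ {k n} (G : GenMatrix k n) {a b i} →
  (∀ c → lincomb G c a xor lincomb G c b ≡ lincomb G c i) → i ≢ a → i ≢ b → LocalAt G 2 i
parity⇒local G {a} {b} {i} parity i≢a i≢b = ⁅ a ⁆ ∪ ⁅ b ⁆ , i∉S , size , recover
  where
  i∉S : i ∉ ⁅ a ⁆ ∪ ⁅ b ⁆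
  i∉S i∈S with x∈p∪q⁻ ⁅ a ⁆ ⁅ b ⁆ i∈S
  ... | inj₁ i∈a = i≢a (x∈⁅y⁆⇒x≡y a i∈a)
  ... | inj₂ i∈b = i≢b (x∈⁅y⁆⇒x≡y b i∈b)
  size : ∣ ⁅ a ⁆ ∪ ⁅ b ⁆ ∣ ≤ 2
  size = ≤-trans (∣p∪q∣≤∣p∣+∣q∣ ⁅ a ⁆ ⁅ b ⁆) (≤-reflexive (cong₂ _+_ (∣⁅x⁆∣≡1 a) (∣⁅x⁆∣≡1 b)))
  recover : ∀ c c′ → (∀ j → j ∈ ⁅ a ⁆ ∪ ⁅ b ⁆ → lincomb G c j ≡ lincomb G c′ j) → lincomb G c i ≡ lincomb G c′ i
  recover c c′ agree = trans (sym (parity c)) (trans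
    (cong₂ _xor_ (agree a (p⊆p∪q ⁅ b ⁆ (x∈⁅x⁆ a))) (agree b (q⊆p∪q ⁅ a ⁆ ⁅ b ⁆ (x∈⁅x⁆ b))))
    (parity c′))

-- The first-order Reed–Muller code of length 2 ^ (m + 1), whose codewords are the affine maps
-- y ↦ c₀ + ⟨c′, y⟩ on F₂^(m+1), with the extra coordinate c₁ = ⟨c′, e₀⟩ appended.
module ExtendedReedMuller (m : ℕ) where

  N = 2 ^ suc m

  column′ : Fin N ⊎ Fin 1 → Vec Bool (suc (suc m))
  column′ (inj₁ i) = true ∷ bits {suc m} i
  column′ (inj₂ _) = false ∷ unit zero

  generator : GenMatrix (suc (suc m)) (N + 1)
  generator r p = lookup (column′ (splitAt N p)) r

  codeword : (Fin (suc (suc m)) → Bool) → Word (N + 1)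
  codeword = lincomb generator

  affine : (Fin (suc (suc m)) → Bool) → Vec Bool (suc m) → Bool
  affine c y = c zero xor dot (c ∘ suc) y

  extra : Fin (N + 1)
  extra = N ↑ʳ zero

  partner : Fin N → Fin N
  partner i = index (bits {suc m} i ⊕ unit zero)

  codeword≡dot : ∀ c p → codeword c p ≡ dot c (column′ (splitAt N p))
  codeword≡dot c p = trans (lincomb≡dot generator c p) (cong (dot c) (tabulate∘lookup (column′ (splitAt N p))))

  codeword-↑ˡ : ∀ c i → codeword c (i ↑ˡ 1) ≡ affine c (bits {suc m} i)
  codeword-↑ˡ c i = trans (codeword≡dot c (i ↑ˡ 1)) (trans (cong (dot c ∘ column′) (splitAt-↑ˡ N i 1))
    (cong (_xor dot (c ∘ suc) (bits {suc m} i)) (∧-identityʳ (c zero))))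

  codeword-extra : ∀ c → codeword c extra ≡ c (suc zero)
  codeword-extra c = trans (codeword≡dot c extra) (trans (cong (dot c ∘ column′) (splitAt-↑ʳ N 1 zero))
    (trans (cong (_xor dot (c ∘ suc) (unit zero)) (∧-zeroʳ (c zero))) (dot-unit (c ∘ suc) zero)))

  codeword-parity : ∀ c i → codeword c (i ↑ˡ 1) xor codeword c (partner i ↑ˡ 1) ≡ codeword c extra
  codeword-parity c i = begin
    codeword c (i ↑ˡ 1) xor codeword c (partner i ↑ˡ 1)
      ≡⟨ cong₂ _xor_ (codeword-↑ˡ c i)
           (trans (codeword-↑ˡ c (partner i)) (cong (affine c) (bits-index (y ⊕ unit zero)))) ⟩
    affine c y xor affine c (y ⊕ unit zero)
      ≡⟨ cong (λ z → affine c y xor (c zero xor z)) (dot-linear (c ∘ suc) y (unit zero)) ⟩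
    (c zero xor dot (c ∘ suc) y) xor (c zero xor (dot (c ∘ suc) y xor dot (c ∘ suc) (unit zero)))
      ≡⟨ trans (xor-cancel-common (c zero) _ _) (xor-cancelˡ (dot (c ∘ suc) y) _) ⟩
    dot (c ∘ suc) (unit zero)
      ≡⟨ dot-unit (c ∘ suc) zero ⟩
    c (suc zero)
      ≡⟨ codeword-extra c ⟨
    codeword c extra ∎
    where
    open ≡-Reasoning
    y = bits {suc m} i

  2^m≤count-affine : ∀ c j → c j ≡ true → 2 ^ m ≤ count (affine c)
  2^m≤count-affine c j cj with any? (λ r → c (suc r) ≟ᵇ true)
  ... | yes (r , cr) = ≤-reflexive (sym (*-cancelˡ-≡ (count (affine c)) (2 ^ m) 2
          (2*count-affine≡ {x = dot (c ∘ suc)} {unit r}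
             (dot-linear (c ∘ suc)) (trans (dot-unit (c ∘ suc) r) cr) (c zero))))
  ... | no c′≢0 = begin
    2 ^ m                      ≤⟨ m≤m+n (2 ^ m) _ ⟩
    2 ^ suc m                  ≡⟨ trans (∑-const {suc m} 1) (*-identityʳ (2 ^ suc m)) ⟨
    ∑ {suc m} (λ _ → 1)        ≡⟨ ∑-cong (λ y → cong [_] (sym (affine≡true y))) ⟩
    count (affine c)           ∎
    where
    open ≤-Reasoning
    c′≡0 : ∀ r → c (suc r) ≡ false
    c′≡0 r = ¬-not λ cr → c′≢0 (r , cr)
    c₀≡true : ∀ j → c j ≡ true → c zero ≡ true
    c₀≡true zero cj = cj
    c₀≡true (suc r) cj = contradiction (trans (sym cj) (c′≡0 r)) λ ()
    affine≡true : ∀ y → affine c y ≡ true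
    affine≡true y rewrite c₀≡true j cj | dot-zeroˡ c′≡0 y = refl

  weights : WeightsAtLeast generator (2 ^ m)
  weights c j cj = begin
    2 ^ m                                ≤⟨ 2^m≤count-affine c j cj ⟩
    count (affine c)                     ≡⟨ weight-bits (affine c) ⟨
    weight (affine c ∘ bits {suc m})     ≡⟨ weight-cong (λ i → sym (codeword-↑ˡ c i)) ⟩
    weight (λ i → codeword c (i ↑ˡ 1))   ≤⟨ m≤m+n _ _ ⟩
    weight (λ i → codeword c (i ↑ˡ 1)) + weight (λ i → codeword c (N ↑ʳ i))
                                         ≡⟨ weight-++ N (codeword c) ⟨
    weight (codeword c)                  ∎
    where open ≤-Reasoning

  local-↑ˡ : ∀ i → LocalAt generator 2 (i ↑ˡ 1)
  local-↑ˡ i = parity⇒local generator (λ c → xor-solve (codeword-parity c i)) i≢partner (↑ˡ≢↑ʳ i zero)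
    where
    i≢partner : i ↑ˡ 1 ≢ partner i ↑ˡ 1
    i≢partner eq = ⊕-unit-≢ (bits {suc m} i) zero
      (sym (trans (cong bits (↑ˡ-injective 1 i (partner i) eq)) (bits-index (bits {suc m} i ⊕ unit zero))))

  local-extra : LocalAt generator 2 extra
  local-extra = parity⇒local generator (λ c → codeword-parity c i₀)
    (λ eq → ↑ˡ≢↑ʳ i₀ zero (sym eq)) (λ eq → ↑ˡ≢↑ʳ (partner i₀) zero (sym eq))
    where
    i₀ = index (replicate (suc m) false)

  locality : HasLocality generator 2
  locality p = local-split p (splitAt N p) refl
    where
    local-split : ∀ p s → splitAt N p ≡ s → LocalAt generator 2 p
    local-split p (inj₁ i)    eq = subst (LocalAt generator 2) (splitAt⁻¹-↑ˡ eq) (local-↑ˡ i)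
    local-split p (inj₂ zero) eq = subst (LocalAt generator 2) (splitAt⁻¹-↑ʳ eq) local-extra

  code : ExistsCode (N + 1) (suc (suc m)) (2 ^ m) 2
  code = generator , weightsAtLeast⇒linIndep {G = generator} (m^n>0 2 m) weights ,
         weightsAtLeast⇒minDist {G = generator} weights , locality

proposition22 : ∀ (k : ℕ) → 2 ≤ k → MinLengthIs k (2 ^ (k ∸ 2)) 2 (2 ^ (k ∸ 1) + 1)
proposition22 1 (s≤s ())
proposition22 (suc (suc m)) _ = ExtendedReedMuller.code m , no-shorter-code
  where
  no-shorter-code : ∀ n → n < 2 ^ suc m + 1 → ¬ ExistsCode n (suc (suc m)) (2 ^ m) 2
  no-shorter-code zero _ (_ , independent , _) = contradiction (independent (λ _ → true) (λ ()) zero) λ ()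
  no-shorter-code (suc n) n<N+1 code =
    let s , h , s≤2 , dimension , bound = shortened-plotkin code in
    shortened-plotkin-infeasible (2 ^ m) s h (suc n) (m^n>0 2 m) s≤2
      (m<1+n⇒m≤n (subst (suc n <_) (+-comm (2 ^ suc m) 1) n<N+1)) dimension bound
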